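{- Let $q=p^s$ with $p$ prime, let $0\le i\le s-1$ and $h=\gcd(i,s)$. For $c\in\mathbb{F}_q$: if $c\in C_0^{(p^h-1,q)}$ then $M_0(x^{p^i},c)=p^s-p^{s-h}$, $M_{p^h}(x^{p^i},c)=p^{s-h}$, and all other $M_j(x^{p^i},c)$ are $0$; if $c\notin C_0^{(p^h-1,q)}$ then $M_1(x^{p^i},c)=p^s$ and all other $M_j(x^{p^i},c)$ are $0$.
   Context: For a polynomial $f$ over $\mathbb{F}_q$ and $c\in\mathbb{F}_q$, $M_j(f,c)$ is the number of elements of $\mathbb{F}_q$ occurring exactly $j$ times in the multiset $\{f(x)-cx\mid x\in\mathbb{F}_q\}$. $C_0^{(N,q)}$ denotes the set of nonzero $N$-th powers in $\mathbb{F}_q$. By convention $\gcd(0,s)=s$. -}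

module Defs where

open import Level using (0ℓ)
open import Data.Nat using (ℕ; zero; suc)
open import Data.Fin using (Fin)
open import Data.Fin.Properties using () renaming (_≟_ to _≟ᶠ_)
open import Data.List using (List; map; filter; length)
open import Data.List.Base using ()
open import Data.Fin.Base using ()
open import Data.Product using (Σ; _×_; _,_)
open import Function.Bundles using (_↔_; Inverse)
open import Relation.Nullary using (¬_; Dec; yes; no)
open import Relation.Nullary.Decidable using (map′)
open import Relation.Binary.PropositionalEquality using (_≡_; _≢_; refl; cong)
open import Algebra.Structures using (IsCommutativeRing)
import Data.List as L
open import Data.Vec.Functional using ()
open import Data.List.Base using (allFin)

record FiniteField : Set₁ where
  infixl 6 _+_
  infixl 7 _*_
  field
    F       : Set
    _+_ _*_ : F → F → F
    -_      : F → F
    0# 1#   : F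
    isCommutativeRing : IsCommutativeRing _≡_ _+_ _*_ -_ 0# 1#
    0≢1     : 0# ≢ 1#
    inverse : ∀ x → x ≢ 0# → Σ F (λ y → x * y ≡ 1#)
    size    : ℕ
    enum    : F ↔ Fin size

  open Inverse enum public using (to; from; inverseʳ; inverseˡ; to-cong)

  _≟_ : (x y : F) → Dec (x ≡ y)
  x ≟ y = map′ inj (cong to) (to x ≟ᶠ to y)
    where
    inj : to x ≡ to y → x ≡ y
    inj e with inverseʳ {x = x} refl | inverseʳ {x = y} refl
    ... | ex | ey rewrite e = Relation.Binary.PropositionalEquality.trans (Relation.Binary.PropositionalEquality.sym ex) ey

  elements : List F
  elements = map from (allFin size)

  _^_ : F → ℕ → F
  x ^ zero  = 1#
  x ^ suc n = x * (x ^ n)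

  occurrences : (F → F) → F → ℕ
  occurrences g y = length (filter (λ x → g x ≟ y) elements)

  M : ℕ → (F → F) → F → ℕ
  M j f c = length (filter (λ y → occurrences (λ x → f x + (- (c * x))) y Data.Nat.≟ j) elements)

  C₀ : ℕ → F → Set
  C₀ N c = (c ≢ 0#) × Σ F (λ y → y ^ N ≡ c)

module Submission where

-- In characteristic p the map  L_c(x) = x^(p^i) - c x  is additive
-- (the binomial coefficients p C k, 0 < k < p, vanish), so every nonempty
-- fibre of L_c is a translate of its kernel.  Writing k = |ker L_c|, each
-- value is therefore taken exactly k times: M_k = q / k, M_0 = q - q / k and
-- all other M_j vanish (module AdditiveFibres).  It remains to compute k,
-- with h = gcd(i, s) and d = p^h - 1 (module TwistedFrobeniusKernel):
--  * a nonzero root x of L_c gives c = x^(p^i - 1) = (x^G)^d, as d ∣ p^i - 1;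
--    so if c is not a nonzero d-th power, k = 1;
--  * if c = y^d ≠ 0, some x₀ ≠ 0 satisfies x₀^(p^i) = c x₀, and x ↦ x / x₀
--    maps ker L_c onto the fixed points of x ↦ x^(p^i); by Bézout and
--    Fermat (x^q = x) these are the fixed points of x ↦ x^(p^h), of which
--    there are exactly p^h (module FrobeniusFixedPoints): at most p^h as roots
--    of x^(p^h) - x, and at least p^h because the values of the additive map
--    x^(p^h) - x are roots of a trace polynomial of degree p^(s-h).

open import Defs
open import Level using (0ℓ)
open import Data.Nat as ℕ using (ℕ; zero; suc; _∸_; _<_; _≤_; z≤n; s≤s)
import Data.Nat.Properties as ℕP
import Data.Nat.Divisibility as ℕ∣
open import Data.Nat.DivMod using (m/n*n≡m)
open import Data.Nat.GCD using (GCD; module Bézout; gcd; gcd-GCD; gcd[m,n]∣m; gcd[m,n]∣n; gcd-identityˡ)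
open import Data.Nat.Primality using (Prime; prime⇒nonTrivial; euclidsLemma; ¬prime[1])
open import Data.Nat.ListAction using (sum)
import Data.Nat.Solver
open import Data.Fin as Fin using (Fin; punchIn)
import Data.Fin.Properties as FinP
open import Data.Fin.Permutation using (Permutation; permutation)
open import Data.Product using (Σ; _×_; _,_; proj₁; proj₂)
open import Data.Sum using (_⊎_; inj₁; inj₂)
open import Data.Empty using (⊥-elim)
open import Data.Maybe using (Maybe; just; nothing)
open import Data.List using (List; []; _∷_; length; filter; map; allFin)
open import Data.List.Properties using (length-map; filter-accept; filter-reject; length-tabulate)
open import Data.List.Relation.Unary.All using (All; []; _∷_)
open import Data.List.Relation.Unary.AllPairs using ([]; _∷_)
open import Data.List.Relation.Unary.Any using (here; there)
open import Data.List.Membership.Propositional using (_∈_)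
open import Data.List.Membership.Propositional.Properties
  using (∈-map⁺; ∈-map⁻; ∈-allFin; ∈-filter⁺; ∈-filter⁻)
open import Data.List.Relation.Unary.Unique.Propositional using (Unique)
import Data.List.Relation.Unary.Unique.Propositional.Properties as Unique
open import Function using (id)
open import Relation.Nullary using (¬_; Dec; yes; no; ¬?)
open import Relation.Nullary.Decidable using (decidable-stable)
open import Relation.Binary.PropositionalEquality
open import Algebra.Bundles using (CommutativeRing; RawRing; CommutativeMonoid)
import Algebra.Solver.Ring.AlmostCommutativeRing as ACR
import Algebra.Solver.Ring as RingSolver
import Algebra.Properties.CommutativeMonoid.Sum as Sum
import Algebra.Properties.CommutativeSemiring.Binomial
open import Algebra.Properties.CommutativeSemigroup ℕP.+-commutativeSemigroup
  using () renaming (interchange to +-interchange)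

module NaturalNumbers where
  open import Data.Nat using (_+_; _*_; _^_; _!)
  open import Data.Nat.Combinatorics using (_C_; nCk≡n!/k![n-k]!; k![n∸k]!∣n!)
  open ℕP using (<-trans; <⇒≤; n<1+n; ∸-monoʳ-<; *-zeroʳ; _!*_!≢0)
  open ℕ∣ using (_∣_; m∣m*n; ∣1⇒≡1; >⇒∤)
  open Data.Nat.Solver.+-*-Solver using (solve; _:+_; _:*_; _:=_; con)

  prime∤factorial : ∀ {p m} → Prime p → m < p → ¬ (p ∣ m !)
  prime∤factorial {m = zero} pp _ p∣1 with ∣1⇒≡1 p∣1
  ... | refl = ¬prime[1] pp
  prime∤factorial {m = suc m} pp m<p p∣m! with euclidsLemma (suc m) (m !) pp p∣m!
  ... | inj₁ p∣1+m = >⇒∤ m<p p∣1+m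
  ... | inj₂ p∣m!′ = prime∤factorial pp (<-trans (n<1+n m) m<p) p∣m!′

  -- The inner binomial coefficients of a prime are divisible by it; this
  -- is what makes  x ↦ x^p  additive in characteristic p.
  prime∣binomial : ∀ {p k} → Prime p → 0 < k → k < p → p ∣ p C k
  prime∣binomial {p@(suc r)} {k} pp 0<k k<p
    with euclidsLemma (p C k) (k ! * (p ∸ k) !) pp p∣C*k!*[p-k]!
    where
    instance _ = k !* (p ∸ k) !≢0
    -- p ! = (p C k) · k! · (p-k)!,  and p divides p ! = p · r !
    p!≡C*k!*[p-k]! : p ! ≡ (p C k) * (k ! * (p ∸ k) !)
    p!≡C*k!*[p-k]! = sym (trans (cong (_* (k ! * (p ∸ k) !)) (nCk≡n!/k![n-k]! (<⇒≤ k<p)))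
                               (m/n*n≡m (k![n∸k]!∣n! (<⇒≤ k<p))))
    p∣C*k!*[p-k]! : p ∣ (p C k) * (k ! * (p ∸ k) !)
    p∣C*k!*[p-k]! = subst (p ∣_) p!≡C*k!*[p-k]! (m∣m*n (r !))
  ... | inj₁ p∣C = p∣C
  ... | inj₂ p∣k!*[p-k]! with euclidsLemma (k !) ((p ∸ k) !) pp p∣k!*[p-k]!
  ...   | inj₁ p∣k!     = ⊥-elim (prime∤factorial pp k<p p∣k!)
  ...   | inj₂ p∣[p-k]! = ⊥-elim (prime∤factorial pp (∸-monoʳ-< 0<k (<⇒≤ k<p)) p∣[p-k]!)

  -- e divides (1+e)^a - 1; used to see that p^h - 1 divides p^(h a) - 1.
  geometric-quotient : ∀ e a → Σ ℕ (λ g → suc e ^ a ≡ suc (e * g))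
  geometric-quotient e zero = 0 , cong suc (sym (*-zeroʳ e))
  geometric-quotient e (suc a) with geometric-quotient e a
  ... | g , eq = suc (suc e * g) , trans (cong (suc e *_) eq)
      (solve 2 (λ e g → (con 1 :+ e) :* (con 1 :+ e :* g)
                      := con 1 :+ e :* (con 1 :+ (con 1 :+ e) :* g)) refl e g)

  bezout : ∀ {i s h} → GCD i s h → 0 < i → 0 < s → Σ ℕ (λ a → Σ ℕ (λ b → a * i ≡ h + b * s))
  bezout {suc i} {suc s} {h} g _ _ with Bézout.identity g
  ... | Bézout.+- x y eq = x , y , sym eq
  ... | Bézout.-+ x y eq = x * s + y * suc s , x * suc i + y * i , sym (begin
    h + (x * suc i + y * i) * suc s
      ≡⟨ solve 5 (λ h x y i s → h :+ (x :* (con 1 :+ i) :+ y :* i) :* (con 1 :+ s)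
                := (h :+ x :* (con 1 :+ i)) :+ (x :* (con 1 :+ i) :* s :+ y :* i :* (con 1 :+ s)))
               refl h x y i s ⟩
    (h + x * suc i) + (x * suc i * s + y * i * suc s)
      ≡⟨ cong (_+ (x * suc i * s + y * i * suc s)) eq ⟩
    y * suc s + (x * suc i * s + y * i * suc s)
      ≡⟨ solve 4 (λ x y i s → y :* (con 1 :+ s) :+ (x :* (con 1 :+ i) :* s :+ y :* i :* (con 1 :+ s))
                := (x :* s :+ y :* (con 1 :+ s)) :* (con 1 :+ i)) refl x y i s ⟩
    (x * s + y * suc s) * suc i ∎)
    where open ≡-Reasoning

open NaturalNumbers

module FieldArithmetic (K : FiniteField) where
  open FiniteField K

  ring : CommutativeRing 0ℓ 0ℓ
  ring = record { isCommutativeRing = isCommutativeRing }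

  open CommutativeRing ring public
    using ( +-assoc; +-comm; *-assoc; *-comm; +-identityˡ; +-identityʳ
          ; *-identityˡ; *-identityʳ; distribˡ; distribʳ; -‿inverseˡ; -‿inverseʳ
          ; zeroˡ; zeroʳ; semiring; commutativeSemiring
          ; +-commutativeMonoid; *-commutativeMonoid )
  open import Algebra.Properties.Ring (CommutativeRing.ring ring) public
    using (-‿distribˡ-*; -‿distribʳ-*; -‿involutive; -0#≈0#)
  open import Algebra.Properties.AbelianGroup (CommutativeRing.+-abelianGroup ring)
    using (⁻¹-∙-comm)
  open import Algebra.Properties.Semiring.Mult semiring public
    using (×-homo-+; ×1-homo-*) renaming (_×_ to _×ᴷ_)
  import Algebra.Properties.Semiring.Exp semiring as Exp
  import Algebra.Properties.CommutativeSemiring.Exp commutativeSemiring as CExp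
  open ≡-Reasoning

  ι : ℕ → F
  ι n = n ×ᴷ 1#

  ι-+ : ∀ m n → ι (m ℕ.+ n) ≡ ι m + ι n
  ι-+ = ×-homo-+ 1#

  ι-* : ∀ m n → ι (m ℕ.* n) ≡ ι m * ι n
  ι-* = ×1-homo-*

  -- A ring solver for K.  Its coefficients are formal differences  a - b  of
  -- naturals, interpreted through ι; equality of coefficients is decided in ℕ.
  module Solver where
    FormalDifference : RawRing 0ℓ 0ℓ
    FormalDifference = record
      { Carrier = ℕ × ℕ ; _≈_ = _≡_
      ; _+_ = λ { (a , b) (c , d) → (a ℕ.+ c , b ℕ.+ d) }
      ; _*_ = λ { (a , b) (c , d) → (a ℕ.* c ℕ.+ b ℕ.* d , a ℕ.* d ℕ.+ b ℕ.* c) }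
      ; -_  = λ { (a , b) → (b , a) }
      ; 0#  = (0 , 0) ; 1# = (1 , 0) }

    ⟦_⟧ : ℕ × ℕ → F
    ⟦ a , b ⟧ = ι a + - ι b

    -- The three identities below make ⟦_⟧ a ring homomorphism.
    sub-+ : ∀ A B C D → (A + - B) + (C + - D) ≡ (A + C) + - (B + D)
    sub-+ A B C D = begin
      (A + - B) + (C + - D) ≡⟨ +-assoc A (- B) _ ⟩
      A + (- B + (C + - D)) ≡⟨ cong (A +_) (sym (+-assoc (- B) C _)) ⟩
      A + ((- B + C) + - D) ≡⟨ cong (λ z → A + (z + - D)) (+-comm (- B) C) ⟩
      A + ((C + - B) + - D) ≡⟨ cong (A +_) (+-assoc C (- B) _) ⟩
      A + (C + (- B + - D)) ≡⟨ sym (+-assoc A C _) ⟩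
      (A + C) + (- B + - D) ≡⟨ cong ((A + C) +_) (⁻¹-∙-comm B D) ⟩
      (A + C) + - (B + D)   ∎

    sub-* : ∀ A B C D → (A + - B) * (C + - D) ≡ (A * C + B * D) + - (A * D + B * C)
    sub-* A B C D = begin
      (A + - B) * (C + - D)
        ≡⟨ distribʳ _ _ _ ⟩
      A * (C + - D) + (- B) * (C + - D)
        ≡⟨ cong₂ _+_ (distribˡ _ _ _) (distribˡ _ _ _) ⟩
      (A * C + A * (- D)) + ((- B) * C + (- B) * (- D))
        ≡⟨ cong₂ (λ u v → (A * C + u) + (v + (- B) * (- D))) (sym (-‿distribʳ-* A D)) (sym (-‿distribˡ-* B C)) ⟩
      (A * C + - (A * D)) + (- (B * C) + (- B) * (- D))
        ≡⟨ cong (λ z → (A * C + - (A * D)) + (- (B * C) + z)) neg*neg ⟩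
      (A * C + - (A * D)) + (- (B * C) + B * D)
        ≡⟨ cong ((A * C + - (A * D)) +_) (+-comm _ _) ⟩
      (A * C + - (A * D)) + (B * D + - (B * C))
        ≡⟨ sub-+ _ _ _ _ ⟩
      (A * C + B * D) + - (A * D + B * C) ∎
      where
      neg*neg : (- B) * (- D) ≡ B * D
      neg*neg = trans (sym (-‿distribˡ-* B (- D)))
                      (trans (cong -_ (sym (-‿distribʳ-* B D))) (-‿involutive _))

    neg-sub : ∀ A B → - (A + - B) ≡ B + - A
    neg-sub A B = begin
      - (A + - B)  ≡⟨ sym (⁻¹-∙-comm A (- B)) ⟩
      - A + - - B  ≡⟨ cong (- A +_) (-‿involutive B) ⟩
      - A + B      ≡⟨ +-comm _ _ ⟩
      B + - A      ∎

    morphism : FormalDifference ACR.-Raw-AlmostCommutative⟶ ACR.fromCommutativeRing ring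
    morphism = record
      { ⟦_⟧    = ⟦_⟧
      ; +-homo = λ { (a , b) (c , d) → trans (cong₂ (λ u v → u + - v) (ι-+ a c) (ι-+ b d))
                                              (sym (sub-+ _ _ _ _)) }
      ; *-homo = λ { (a , b) (c , d) → trans (cong₂ (λ u v → u + - v)
                       (trans (ι-+ (a ℕ.* c) (b ℕ.* d)) (cong₂ _+_ (ι-* a c) (ι-* b d)))
                       (trans (ι-+ (a ℕ.* d) (b ℕ.* c)) (cong₂ _+_ (ι-* a d) (ι-* b c))))
                       (sym (sub-* _ _ _ _)) }
      ; -‿homo = λ { (a , b) → sym (neg-sub _ _) }
      ; 0-homo = trans (+-identityˡ _) -0#≈0#
      ; 1-homo = trans (cong (_+ - 0#) (+-identityʳ 1#)) (trans (cong (1# +_) -0#≈0#) (+-identityʳ _))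
      }

    -- A + D = C + B  implies  A - B = C - D: soundness of the coefficient test.
    sub-eq : ∀ A B C D → A + D ≡ C + B → A + - B ≡ C + - D
    sub-eq A B C D e = begin
      A + - B                 ≡⟨ sym (+-identityʳ _) ⟩
      (A + - B) + 0#          ≡⟨ cong ((A + - B) +_) (sym (-‿inverseʳ D)) ⟩
      (A + - B) + (D + - D)   ≡⟨ sub-+ A B D D ⟩
      (A + D) + - (B + D)     ≡⟨ cong (λ z → z + - (B + D)) e ⟩
      (C + B) + - (B + D)     ≡⟨ cong (λ z → (C + B) + - z) (+-comm B D) ⟩
      (C + B) + - (D + B)     ≡⟨ sym (sub-+ C D B B) ⟩
      (C + - D) + (B + - B)   ≡⟨ cong ((C + - D) +_) (-‿inverseʳ B) ⟩
      (C + - D) + 0#          ≡⟨ +-identityʳ _ ⟩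
      C + - D                 ∎

    coefficient≟ : (x y : ℕ × ℕ) → Maybe (⟦ x ⟧ ≡ ⟦ y ⟧)
    coefficient≟ (a , b) (c , d) with a ℕ.+ d ℕ.≟ c ℕ.+ b
    ... | yes e = just (sub-eq _ _ _ _ (trans (sym (ι-+ a d)) (trans (cong ι e) (ι-+ c b))))
    ... | no _  = nothing

    open RingSolver FormalDifference (ACR.fromCommutativeRing ring) morphism coefficient≟ public
      using (solve; _:+_; _:*_; _:-_; _:=_)

  open Solver public using (solve; _:+_; _:*_; _:-_; _:=_)

  1≢0 : 1# ≢ 0#
  1≢0 e = 0≢1 (sym e)

  sub≡0⇒≡ : ∀ {a b} → a + - b ≡ 0# → a ≡ b
  sub≡0⇒≡ {a} {b} e = begin
    a             ≡⟨ solve 2 (λ a b → a := (a :- b) :+ b) refl a b ⟩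
    (a + - b) + b ≡⟨ cong (_+ b) e ⟩
    0# + b        ≡⟨ +-identityˡ b ⟩
    b             ∎

  ≡⇒sub≡0 : ∀ {a b} → a ≡ b → a + - b ≡ 0#
  ≡⇒sub≡0 {a} refl = -‿inverseʳ a

  +-cancelˡ-≡0 : ∀ {x y} → x + y ≡ x → y ≡ 0#
  +-cancelˡ-≡0 {x} {y} e = begin
    y             ≡⟨ solve 2 (λ x y → y := (x :+ y) :- x) refl x y ⟩
    (x + y) + - x ≡⟨ cong (_+ - x) e ⟩
    x + - x       ≡⟨ -‿inverseʳ x ⟩
    0#            ∎

  no-zero-divisors : ∀ {x y} → x * y ≡ 0# → x ≡ 0# ⊎ y ≡ 0#
  no-zero-divisors {x} {y} e with x ≟ 0#
  ... | yes x≡0 = inj₁ x≡0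
  ... | no x≢0 with inverse x x≢0
  ...   | u , xu≡1 = inj₂ (begin
    y           ≡⟨ sym (*-identityˡ y) ⟩
    1# * y      ≡⟨ cong (_* y) (sym xu≡1) ⟩
    (x * u) * y ≡⟨ solve 3 (λ x u y → (x :* u) :* y := u :* (x :* y)) refl x u y ⟩
    u * (x * y) ≡⟨ cong (u *_) e ⟩
    u * 0#      ≡⟨ zeroʳ u ⟩
    0#          ∎)

  *-≢0 : ∀ {x y} → x ≢ 0# → y ≢ 0# → x * y ≢ 0#
  *-≢0 x≢0 y≢0 e with no-zero-divisors e
  ... | inj₁ x≡0 = x≢0 x≡0
  ... | inj₂ y≡0 = y≢0 y≡0

  *-cancelˡ : ∀ {x a b} → x ≢ 0# → x * a ≡ x * b → a ≡ b
  *-cancelˡ {x} {a} {b} x≢0 e with no-zero-divisors x*[a-b]≡0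
    where
    x*[a-b]≡0 : x * (a + - b) ≡ 0#
    x*[a-b]≡0 = trans (solve 3 (λ x a b → x :* (a :- b) := x :* a :- x :* b) refl x a b) (≡⇒sub≡0 e)
  ... | inj₁ x≡0   = ⊥-elim (x≢0 x≡0)
  ... | inj₂ a-b≡0 = sub≡0⇒≡ a-b≡0

  -- Powers.  The library's laws for the semiring power  x ^ n  are transported
  -- to the power of Defs, which unfolds in the same way.
  ^≡^ᴿ : ∀ x n → x ^ n ≡ x Exp.^ n
  ^≡^ᴿ x zero = refl
  ^≡^ᴿ x (suc n) = cong (x *_) (^≡^ᴿ x n)

  ^-* : ∀ x m n → x ^ (m ℕ.* n) ≡ (x ^ m) ^ n
  ^-* x m n = trans (^≡^ᴿ x (m ℕ.* n)) (trans (sym (Exp.^-assocʳ x m n))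
    (sym (trans (^≡^ᴿ (x ^ m) n) (cong (Exp._^ n) (^≡^ᴿ x m)))))

  *-^ : ∀ x y n → (x * y) ^ n ≡ x ^ n * y ^ n
  *-^ x y n = trans (^≡^ᴿ (x * y) n)
    (trans (CExp.^-distrib-* x y n) (sym (cong₂ _*_ (^≡^ᴿ x n) (^≡^ᴿ y n))))

  ^≢0 : ∀ {x} n → x ≢ 0# → x ^ n ≢ 0#
  ^≢0 zero x≢0 = 1≢0
  ^≢0 (suc n) x≢0 = *-≢0 x≢0 (^≢0 n x≢0)

  0^n≡0 : ∀ {n} → 0 ℕ.< n → 0# ^ n ≡ 0#
  0^n≡0 {suc n} _ = zeroˡ _

  ^≡0⇒≡0 : ∀ {x} n → x ^ n ≡ 0# → x ≡ 0#
  ^≡0⇒≡0 {x} n e with x ≟ 0#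
  ... | yes x≡0 = x≡0
  ... | no x≢0 = ⊥-elim (^≢0 n x≢0 e)

  ι-^ : ∀ m n → ι (m ℕ.^ n) ≡ ι m ^ n
  ι-^ m zero = +-identityʳ 1#
  ι-^ m (suc n) = trans (ι-* m (m ℕ.^ n)) (cong (ι m *_) (ι-^ m n))

module ListCounting {A : Set} where

  count : {P : A → Set} → (∀ x → Dec (P x)) → List A → ℕ
  count P? l = length (filter P? l)

  count-accept : ∀ {P : A → Set} (P? : ∀ x → Dec (P x)) {x l} → P x → count P? (x ∷ l) ≡ suc (count P? l)
  count-accept P? px = cong length (filter-accept P? px)

  count-reject : ∀ {P : A → Set} (P? : ∀ x → Dec (P x)) {x l} → ¬ P x → count P? (x ∷ l) ≡ count P? l
  count-reject P? ¬px = cong length (filter-reject P? ¬px)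

  count-cong : ∀ {P Q : A → Set} (P? : ∀ x → Dec (P x)) (Q? : ∀ x → Dec (Q x)) →
               (∀ x → P x → Q x) → (∀ x → Q x → P x) → ∀ l → count P? l ≡ count Q? l
  count-cong P? Q? P⇒Q Q⇒P [] = refl
  count-cong P? Q? P⇒Q Q⇒P (x ∷ l) with P? x | Q? x
  ... | yes px | yes qx = cong suc (count-cong P? Q? P⇒Q Q⇒P l)
  ... | yes px | no ¬qx = ⊥-elim (¬qx (P⇒Q x px))
  ... | no ¬px | yes qx = ⊥-elim (¬px (Q⇒P x qx))
  ... | no ¬px | no ¬qx = count-cong P? Q? P⇒Q Q⇒P l

  count-∷ : ∀ {P : A → Set} (P? : ∀ x → Dec (P x)) x l → count P? (x ∷ l) ≡ count P? (x ∷ []) ℕ.+ count P? l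
  count-∷ P? x l with P? x
  ... | yes _ = refl
  ... | no _  = refl

  count-none : ∀ {P : A → Set} (P? : ∀ x → Dec (P x)) → (∀ x → ¬ P x) → ∀ l → count P? l ≡ 0
  count-none P? ¬P [] = refl
  count-none P? ¬P (x ∷ l) = trans (count-reject P? (¬P x)) (count-none P? ¬P l)

  count-witness : ∀ {P : A → Set} (P? : ∀ x → Dec (P x)) → ∀ l → count P? l ≢ 0 → Σ A P
  count-witness P? [] c≢0 = ⊥-elim (c≢0 refl)
  count-witness P? (x ∷ l) c≢0 with P? x
  ... | yes px = x , px
  ... | no _   = count-witness P? l c≢0

  count-complement : ∀ {P : A → Set} (P? : ∀ x → Dec (P x)) → ∀ l →
                     count P? l ℕ.+ count (λ x → ¬? (P? x)) l ≡ length l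
  count-complement P? [] = refl
  count-complement P? (x ∷ l) with P? x
  ... | yes _ = cong suc (count-complement P? l)
  ... | no _  = trans (ℕP.+-suc _ _) (cong suc (count-complement P? l))

  remove : ∀ {x : A} ys → x ∈ ys → List A
  remove (y ∷ ys) (here _)  = ys
  remove (y ∷ ys) (there p) = y ∷ remove ys p

  length-remove : ∀ {x : A} ys (p : x ∈ ys) → length ys ≡ suc (length (remove ys p))
  length-remove (y ∷ ys) (here _)  = refl
  length-remove (y ∷ ys) (there p) = cong suc (length-remove ys p)

  ∈-remove : ∀ {x z : A} ys (p : x ∈ ys) → z ∈ ys → z ≢ x → z ∈ remove ys p
  ∈-remove (y ∷ ys) (here refl) (here refl) z≢x = ⊥-elim (z≢x refl)
  ∈-remove (y ∷ ys) (here refl) (there q)   z≢x = q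
  ∈-remove (y ∷ ys) (there p)   (here refl) z≢x = here refl
  ∈-remove (y ∷ ys) (there p)   (there q)   z≢x = there (∈-remove ys p q z≢x)

  unique-⊆⇒length-≤ : ∀ {xs ys : List A} → Unique xs → (∀ {z} → z ∈ xs → z ∈ ys) → length xs ≤ length ys
  unique-⊆⇒length-≤ {[]} _ _ = z≤n
  unique-⊆⇒length-≤ {x ∷ xs} {ys} (x∉xs ∷ u) xs⊆ys =
    subst (suc (length xs) ≤_) (sym (length-remove ys x∈ys))
      (s≤s (unique-⊆⇒length-≤ u (λ z∈xs → ∈-remove ys x∈ys (xs⊆ys (there z∈xs)) (z≢x x∉xs z∈xs))))
    where
    x∈ys = xs⊆ys (here refl)
    z≢x : ∀ {x : A} {xs z} → All (x ≢_) xs → z ∈ xs → z ≢ x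
    z≢x (x≢y ∷ _) (here refl) = λ e → x≢y (sym e)
    z≢x (_ ∷ a) (there q) = z≢x a q

module FieldCounting (K : FiniteField) where
  open FiniteField K
  open ListCounting public

  ∈-elements : ∀ x → x ∈ elements
  ∈-elements x = subst (_∈ elements) (inverseʳ refl) (∈-map⁺ from (∈-allFin (to x)))

  elements-unique : Unique elements
  elements-unique = Unique.map⁺ from-injective (Unique.allFin⁺ size)
    where
    from-injective : ∀ {i j} → from i ≡ from j → i ≡ j
    from-injective {i} {j} e = trans (sym (inverseˡ refl)) (trans (cong to e) (inverseˡ refl))

  length-elements : length elements ≡ size
  length-elements = trans (length-map from (allFin size)) (length-tabulate id)

  count-lower : ∀ {P : F → Set} (P? : ∀ x → Dec (P x)) {xs} → Unique xs → (∀ {z} → z ∈ xs → P z) →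
                length xs ≤ count P? elements
  count-lower P? u xs⊆P = unique-⊆⇒length-≤ u (λ {z} z∈ → ∈-filter⁺ P? (∈-elements z) (xs⊆P z∈))

  count-≥1 : ∀ {P : F → Set} (P? : ∀ x → Dec (P x)) {z} → P z → 1 ≤ count P? elements
  count-≥1 P? pz = count-lower P? ([] ∷ []) (λ { (here refl) → pz })

  count-injection : ∀ {P Q : F → Set} (P? : ∀ x → Dec (P x)) (Q? : ∀ x → Dec (Q x)) (f : F → F) →
                    (∀ {x y} → f x ≡ f y → x ≡ y) → (∀ x → P x → Q (f x)) →
                    count P? elements ≤ count Q? elements
  count-injection {P} {Q} P? Q? f f-inj P⇒Qf = subst (_≤ count Q? elements) (length-map f (filter P? elements))
    (count-lower Q? (Unique.map⁺ f-inj (Unique.filter⁺ P? elements-unique)) image⊆Q)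
    where
    image⊆Q : ∀ {z} → z ∈ map f (filter P? elements) → Q z
    image⊆Q z∈ with ∈-map⁻ f z∈
    ... | x , x∈ , refl = P⇒Qf x (proj₂ (∈-filter⁻ P? {xs = elements} x∈))

  count-bijection : ∀ {P Q : F → Set} (P? : ∀ x → Dec (P x)) (Q? : ∀ x → Dec (Q x)) (f g : F → F) →
                    (∀ x → g (f x) ≡ x) → (∀ y → f (g y) ≡ y) →
                    (∀ x → P x → Q (f x)) → (∀ y → Q y → P (g y)) →
                    count P? elements ≡ count Q? elements
  count-bijection P? Q? f g gf fg P⇒Qf Q⇒Pg = ℕP.≤-antisym
    (count-injection P? Q? f (λ {x} {y} e → trans (sym (gf x)) (trans (cong g e) (gf y))) P⇒Qf)
    (count-injection Q? P? g (λ {x} {y} e → trans (sym (fg x)) (trans (cong f e) (fg y))) Q⇒Pg)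

  count-unique : ∀ {P : F → Set} (P? : ∀ x → Dec (P x)) (z : F) → P z → (∀ y → P y → y ≡ z) →
                 count P? elements ≡ 1
  count-unique P? z pz P⇒≡z = ℕP.≤-antisym
    (unique-⊆⇒length-≤ {ys = z ∷ []} (Unique.filter⁺ P? elements-unique)
       (λ {y} y∈ → here (P⇒≡z y (proj₂ (∈-filter⁻ P? {xs = elements} y∈)))))
    (count-≥1 P? pz)

  fibre-sizes-sum : ∀ (g : F → F) l → sum (map (λ y → count (λ x → g x ≟ y) l) elements) ≡ length l
  fibre-sizes-sum g [] = sum-zeros elements
    where
    sum-zeros : ∀ ys → sum (map (λ _ → 0) ys) ≡ 0
    sum-zeros [] = refl
    sum-zeros (_ ∷ ys) = sum-zeros ys
  fibre-sizes-sum g (x ∷ l) = begin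
    sum (map (λ y → count (λ x′ → g x′ ≟ y) (x ∷ l)) elements)
      ≡⟨ split elements ⟩
    count (λ y → g x ≟ y) elements ℕ.+ sum (map (λ y → count (λ x′ → g x′ ≟ y) l) elements)
      ≡⟨ cong₂ ℕ._+_ (count-unique (λ y → g x ≟ y) (g x) refl (λ y e → sym e)) (fibre-sizes-sum g l) ⟩
    suc (length l) ∎
    where
    open ≡-Reasoning
    indicator : ∀ y → count (λ x′ → g x′ ≟ y) (x ∷ []) ≡ count (λ y′ → g x ≟ y′) (y ∷ [])
    indicator y with g x ≟ y
    ... | yes gx≡y = trans (count-accept (λ x′ → g x′ ≟ y) gx≡y) (sym (count-accept (λ y′ → g x ≟ y′) gx≡y))
    ... | no gx≢y  = trans (count-reject (λ x′ → g x′ ≟ y) gx≢y) (sym (count-reject (λ y′ → g x ≟ y′) gx≢y))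
    split : ∀ ys → sum (map (λ y → count (λ x′ → g x′ ≟ y) (x ∷ l)) ys)
                 ≡ count (λ y → g x ≟ y) ys ℕ.+ sum (map (λ y → count (λ x′ → g x′ ≟ y) l) ys)
    split [] = refl
    split (y ∷ ys) = begin
      count (λ x′ → g x′ ≟ y) (x ∷ l) ℕ.+ sum (map (λ y′ → count (λ x′ → g x′ ≟ y′) (x ∷ l)) ys)
        ≡⟨ cong₂ ℕ._+_ (trans (count-∷ (λ x′ → g x′ ≟ y) x l) (cong (ℕ._+ c) (indicator y))) (split ys) ⟩
      (δ ℕ.+ c) ℕ.+ (C ℕ.+ T)
        ≡⟨ +-interchange δ c C T ⟩
      (δ ℕ.+ C) ℕ.+ (c ℕ.+ T)
        ≡⟨ cong (ℕ._+ (c ℕ.+ T)) (sym (count-∷ (λ y′ → g x ≟ y′) y ys)) ⟩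
      count (λ y′ → g x ≟ y′) (y ∷ ys) ℕ.+ (c ℕ.+ T) ∎
      where
      δ = count (λ y′ → g x ≟ y′) (y ∷ [])
      c = count (λ x′ → g x′ ≟ y) l
      C = count (λ y′ → g x ≟ y′) ys
      T = sum (map (λ y′ → count (λ x′ → g x′ ≟ y′) l) ys)

module _ {c ℓ} (M : CommutativeMonoid c ℓ) where
  open CommutativeMonoid M using (Carrier; _≈_; ε; ∙-congˡ; identityʳ) renaming (trans to ≈-trans)
  open Sum M using (sum-remove; sum-cong-≋; sum-replicate-zero) renaming (sum to ∑)

  sum-single : ∀ {n} (v : Fin n → Carrier) i → (∀ j → j ≢ i → v j ≈ ε) → ∑ v ≈ v i
  sum-single {suc n} v i off = ≈-trans (sum-remove {i = i} v) (≈-trans (∙-congˡ rest) (identityʳ (v i)))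
    where
    rest : ∑ (λ j → v (punchIn i j)) ≈ ε
    rest = ≈-trans (sum-cong-≋ (λ j → off (punchIn i j) (FinP.punchInᵢ≢i i j))) (sum-replicate-zero n)

module FermatAndCharacteristic (K : FiniteField) where
  open FiniteField K
  open FieldArithmetic K
  module ΣF = Sum +-commutativeMonoid
  module ΠF = Sum *-commutativeMonoid
  open ≡-Reasoning

  indexPermutation : (σ τ : F → F) → (∀ x → τ (σ x) ≡ x) → (∀ y → σ (τ y) ≡ y) → Permutation size size
  indexPermutation σ τ τσ στ = permutation (λ k → to (σ (from k))) (λ k → to (τ (from k)))
    (λ k → trans (cong (λ z → to (σ z)) (inverseʳ refl)) (trans (cong to (στ (from k))) (inverseˡ refl)))
    (λ k → trans (cong (λ z → to (τ z)) (inverseʳ refl)) (trans (cong to (τσ (from k))) (inverseˡ refl)))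

  Σ-reindex : (σ τ : F → F) → (∀ x → τ (σ x) ≡ x) → (∀ y → σ (τ y) ≡ y) → (g : F → F) →
              ΣF.sum (λ k → g (from k)) ≡ ΣF.sum (λ k → g (σ (from k)))
  Σ-reindex σ τ τσ στ g = trans (ΣF.sum-permute (λ k → g (from k)) (indexPermutation σ τ τσ στ))
    (ΣF.sum-cong-≗ {size} (λ k → cong g (inverseʳ refl)))

  Π-reindex : (σ τ : F → F) → (∀ x → τ (σ x) ≡ x) → (∀ y → σ (τ y) ≡ y) → (g : F → F) →
              ΠF.sum (λ k → g (from k)) ≡ ΠF.sum (λ k → g (σ (from k)))
  Π-reindex σ τ τσ στ g = trans (ΠF.sum-permute (λ k → g (from k)) (indexPermutation σ τ τσ στ))
    (ΠF.sum-cong-≗ {size} (λ k → cong g (inverseʳ refl)))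

  -- |K| · 1 = 0, since  Σ x = Σ (x + 1) = Σ x + |K| · 1.
  characteristic : ι size ≡ 0#
  characteristic = +-cancelˡ-≡0 (sym ΣF≡ΣF+size)
    where
    ΣF≡ΣF+size : ΣF.sum from ≡ ΣF.sum from + ι size
    ΣF≡ΣF+size = begin
      ΣF.sum from
        ≡⟨ Σ-reindex (_+ 1#) (_+ - 1#) (λ x → solve 2 (λ x c → (x :+ c) :- c := x) refl x 1#)
                                       (λ x → solve 2 (λ x c → (x :- c) :+ c := x) refl x 1#) (λ x → x) ⟩
      ΣF.sum (λ k → from k + 1#)
        ≡⟨ ΣF.∑-distrib-+ {size} from (λ _ → 1#) ⟩
      ΣF.sum from + ΣF.sum {size} (λ _ → 1#)
        ≡⟨ cong (ΣF.sum from +_) (ΣF.sum-replicate size) ⟩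
      ΣF.sum from + ι size ∎

  -- The nonzero representative of x (1 in place of 0) and the correction
  -- factor that makes  x ↦ a x  compatible with it.
  nonzeroPart : F → F
  nonzeroPart x with x ≟ 0#
  ... | yes _ = 1#
  ... | no _  = x

  correction : F → F → F
  correction a x with x ≟ 0#
  ... | yes _ = a
  ... | no _  = 1#

  nonzeroPart≢0 : ∀ x → nonzeroPart x ≢ 0#
  nonzeroPart≢0 x with x ≟ 0#
  ... | yes _   = 1≢0
  ... | no x≢0  = x≢0

  nonzeroPart-scale : ∀ a → a ≢ 0# → ∀ x → nonzeroPart (a * x) * correction a x ≡ a * nonzeroPart x
  nonzeroPart-scale a a≢0 x with x ≟ 0# | (a * x) ≟ 0#
  ... | yes _   | yes _     = trans (*-identityˡ a) (sym (*-identityʳ a))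
  ... | yes x≡0 | no ax≢0   = ⊥-elim (ax≢0 (trans (cong (a *_) x≡0) (zeroʳ a)))
  ... | no x≢0  | yes ax≡0  = ⊥-elim (*-≢0 a≢0 x≢0 ax≡0)
  ... | no _    | no _      = *-identityʳ _

  -- The correction factors multiply to a: only x = 0 contributes.
  Π-correction : ∀ a → ΠF.sum (λ k → correction a (from k)) ≡ a
  Π-correction a = trans (sum-single *-commutativeMonoid (λ k → correction a (from k)) (to 0#) off)
                         (trans (cong (correction a) (inverseʳ refl)) at0)
    where
    at0 : correction a 0# ≡ a
    at0 with 0# ≟ 0#
    ... | yes _   = refl
    ... | no 0≢0  = ⊥-elim (0≢0 refl)
    off : ∀ k → k ≢ to 0# → correction a (from k) ≡ 1#
    off k k≢to0 with from k ≟ 0#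
    ... | yes fk≡0 = ⊥-elim (k≢to0 (trans (sym (inverseˡ refl)) (cong to fk≡0)))
    ... | no _     = refl

  Π-scale : ∀ a (v : Fin size → F) → ΠF.sum (λ k → a * v k) ≡ a ^ size * ΠF.sum v
  Π-scale a v = begin
    ΠF.sum (λ k → a * v k)              ≡⟨ ΠF.∑-distrib-+ {size} (λ _ → a) v ⟩
    ΠF.sum {size} (λ _ → a) * ΠF.sum v  ≡⟨ cong (_* ΠF.sum v) (trans (ΠF.sum-replicate size) (sym (^≡^ᴿ a size))) ⟩
    a ^ size * ΠF.sum v                 ∎

  Π-≢0 : ∀ {n} (v : Fin n → F) → (∀ k → v k ≢ 0#) → ΠF.sum v ≢ 0#
  Π-≢0 {zero} v _ = 1≢0
  Π-≢0 {suc n} v v≢0 = *-≢0 (v≢0 Fin.zero) (Π-≢0 (λ k → v (Fin.suc k)) (λ k → v≢0 (Fin.suc k)))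

  -- Fermat for a ≠ 0: with  x̂ = nonzeroPart x  and  P = ∏ x̂ ≠ 0,
  --   a^|K| · P = ∏ a · x̂ = ∏ (a x)^ · ∏ correction a x = P · a,
  -- because x ↦ a x permutes K.
  fermat-nonzero : ∀ a → a ≢ 0# → a ^ size ≡ a
  fermat-nonzero a a≢0 with inverse a a≢0
  ... | u , au≡1 = *-cancelˡ (Π-≢0 x̂ (λ k → nonzeroPart≢0 (from k))) (begin
      P * a ^ size
        ≡⟨ *-comm _ _ ⟩
      a ^ size * P
        ≡⟨ sym (Π-scale a x̂) ⟩
      ΠF.sum (λ k → a * x̂ k)
        ≡⟨ ΠF.sum-cong-≗ {size} (λ k → sym (nonzeroPart-scale a a≢0 (from k))) ⟩
      ΠF.sum (λ k → nonzeroPart (a * from k) * correction a (from k))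
        ≡⟨ ΠF.∑-distrib-+ {size} (λ k → nonzeroPart (a * from k)) (λ k → correction a (from k)) ⟩
      ΠF.sum (λ k → nonzeroPart (a * from k)) * ΠF.sum (λ k → correction a (from k))
        ≡⟨ cong₂ _*_ (sym (Π-reindex (a *_) (u *_) u[ax]≡x a[ux]≡x nonzeroPart)) (Π-correction a) ⟩
      P * a ∎)
    where
    x̂ : Fin size → F
    x̂ k = nonzeroPart (from k)
    P = ΠF.sum x̂
    u[ax]≡x : ∀ x → u * (a * x) ≡ x
    u[ax]≡x x = trans (sym (*-assoc u a x)) (trans (cong (_* x) (trans (*-comm u a) au≡1)) (*-identityˡ x))
    a[ux]≡x : ∀ x → a * (u * x) ≡ x
    a[ux]≡x x = trans (sym (*-assoc a u x)) (trans (cong (_* x) au≡1) (*-identityˡ x))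

  fermat : ∀ a → a ^ size ≡ a
  fermat a with a ≟ 0#
  ... | no a≢0 = fermat-nonzero a a≢0
  ... | yes refl = 0^n≡0 (ℕP.≤-<-trans ℕ.z≤n (FinP.toℕ<n (to 0#)))   -- |K| > 0 as 0 ∈ K

module FreshmansDream (K : FiniteField) where
  open import Data.Nat.Combinatorics using (_C_; nCn≡1)
  open FiniteField K
  open FieldArithmetic K
  module ΣF = Sum +-commutativeMonoid
  module Binomial = Algebra.Properties.CommutativeSemiring.Binomial commutativeSemiring
  open import Algebra.Properties.Semiring.Mult semiring using (×-assoc-*)
  import Algebra.Properties.Semiring.Exp semiring as Exp
  open ≡-Reasoning

  multiple-annihilates : ∀ {p m} → ι p ≡ 0# → p ℕ∣.∣ m → ∀ z → m ×ᴷ z ≡ 0#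
  multiple-annihilates {p} {m} ιp≡0 (ℕ∣.divides q refl) z = begin
    m ×ᴷ z           ≡⟨ cong (m ×ᴷ_) (sym (*-identityˡ z)) ⟩
    m ×ᴷ (1# * z)    ≡⟨ sym (×-assoc-* m 1# z) ⟩
    ι (q ℕ.* p) * z  ≡⟨ cong (_* z) (trans (ι-* q p) (trans (cong (ι q *_) ιp≡0) (zeroʳ (ι q)))) ⟩
    0# * z           ≡⟨ zeroˡ z ⟩
    0#               ∎

  -- (x + y)^p = x^p + y^p: in the binomial expansion only the outer terms survive.
  freshmans-dream : ∀ {p} → Prime p → ι p ≡ 0# → ∀ x y → (x + y) ^ p ≡ x ^ p + y ^ p
  freshmans-dream {suc r} pp ιp≡0 x y = begin
    (x + y) ^ suc r                          ≡⟨ ^≡^ᴿ (x + y) (suc r) ⟩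
    (x + y) Exp.^ suc r                      ≡⟨ Binomial.theorem (suc r) x y ⟩
    term Fin.zero + ΣF.sum (λ k → term (Fin.suc k))
                                             ≡⟨ cong (term Fin.zero +_) (ΣF.sum-init-last (λ k → term (Fin.suc k))) ⟩
    term Fin.zero + (ΣF.sum inner + term (Fin.suc (Fin.fromℕ r)))
                                             ≡⟨ cong (λ z → term Fin.zero + (z + term (Fin.suc (Fin.fromℕ r)))) inner-vanishes ⟩
    term Fin.zero + (0# + term (Fin.suc (Fin.fromℕ r)))
                                             ≡⟨ cong₂ _+_ first-term (trans (+-identityˡ _) last-term) ⟩
    y ^ suc r + x ^ suc r                    ≡⟨ +-comm _ _ ⟩
    x ^ suc r + y ^ suc r                    ∎
    where
    term = Binomial.binomialTerm x y (suc r)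
    inner : Fin r → F
    inner i = term (Fin.suc (Fin.inject₁ i))

    inner-vanishes : ΣF.sum inner ≡ 0#
    inner-vanishes = trans (ΣF.sum-cong-≗ {r} vanish) (ΣF.sum-replicate-zero r)
      where
      vanish : ∀ i → inner i ≡ 0#
      vanish i = multiple-annihilates ιp≡0
        (prime∣binomial pp (ℕ.s≤s ℕ.z≤n)
          (ℕ.s≤s (subst (ℕ._< r) (sym (FinP.toℕ-inject₁ i)) (FinP.toℕ<n i)))) _

    first-term : term Fin.zero ≡ y ^ suc r
    first-term = trans (+-identityʳ _) (trans (*-identityˡ _) (sym (^≡^ᴿ y (suc r))))

    last-term : term (Fin.suc (Fin.fromℕ r)) ≡ x ^ suc r
    last-term = top-term _ (cong suc (FinP.toℕ-fromℕ r))
      where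
      top-term : ∀ t → t ≡ suc r → (suc r C t) ×ᴷ (x Exp.^ t * y Exp.^ (suc r ∸ t)) ≡ x ^ suc r
      top-term t refl = begin
        (suc r C suc r) ×ᴷ (x Exp.^ suc r * y Exp.^ (r ∸ r))
          ≡⟨ cong₂ (λ c e → c ×ᴷ (x Exp.^ suc r * y Exp.^ e)) (nCn≡1 (suc r)) (ℕP.n∸n≡0 r) ⟩
        x Exp.^ suc r * 1# + 0#
          ≡⟨ trans (+-identityʳ _) (*-identityʳ _) ⟩
        x Exp.^ suc r
          ≡⟨ sym (^≡^ᴿ x (suc r)) ⟩
        x ^ suc r ∎

module PolynomialFunctions (K : FiniteField) where
  open FiniteField K
  open FieldArithmetic K

  data Degree≤ : ℕ → (F → F) → Set where
    constant : ∀ {f} a → (∀ x → f x ≡ a) → Degree≤ zero f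
    horner   : ∀ {n f} a g → Degree≤ n g → (∀ x → f x ≡ a + x * g x) → Degree≤ (suc n) f

  data Monic : ℕ → (F → F) → Set where
    one    : ∀ {f} → (∀ x → f x ≡ 1#) → Monic zero f
    horner : ∀ {n f} a g → Monic n g → (∀ x → f x ≡ a + x * g x) → Monic (suc n) f

  Monic⇒Degree≤ : ∀ {n f} → Monic n f → Degree≤ n f
  Monic⇒Degree≤ (one f≡1) = constant 1# f≡1
  Monic⇒Degree≤ (horner a g m e) = horner a g (Monic⇒Degree≤ m) e

  Monic-cong : ∀ {n f g} → Monic n f → (∀ x → g x ≡ f x) → Monic n g
  Monic-cong (one f≡1) g≡f = one (λ x → trans (g≡f x) (f≡1 x))
  Monic-cong (horner a h m e) g≡f = horner a h m (λ x → trans (g≡f x) (e x))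

  Degree≤-suc : ∀ {n f} → Degree≤ n f → Degree≤ (suc n) f
  Degree≤-suc (constant a f≡a) = horner a (λ _ → 0#) (constant 0# (λ _ → refl))
    (λ x → trans (f≡a x) (sym (trans (cong (a +_) (zeroʳ x)) (+-identityʳ a))))
  Degree≤-suc (horner a g d e) = horner a g (Degree≤-suc d) e

  Degree≤-mono : ∀ {m n f} → m ℕ.≤ n → Degree≤ m f → Degree≤ n f
  Degree≤-mono {m} m≤n d with ℕP.m≤n⇒∃[o]m+o≡n m≤n
  ... | o , refl = raise o d
    where
    raise : ∀ {m f} o → Degree≤ m f → Degree≤ (m ℕ.+ o) f
    raise {m} zero d rewrite ℕP.+-identityʳ m = d
    raise {m} (suc o) d rewrite ℕP.+-suc m o = Degree≤-suc (raise o d)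

  Degree≤-scale : ∀ {n f} c → Degree≤ n f → Degree≤ n (λ x → c * f x)
  Degree≤-scale c (constant a f≡a) = constant (c * a) (λ x → cong (c *_) (f≡a x))
  Degree≤-scale c (horner a g d e) = horner (c * a) (λ x → c * g x) (Degree≤-scale c d)
    (λ x → trans (cong (c *_) (e x)) (solve 4 (λ c a x u → c :* (a :+ x :* u) := c :* a :+ x :* (c :* u)) refl c a x (g x)))

  Monic-+-lower : ∀ {n f g} → Monic (suc n) f → Degree≤ n g → Monic (suc n) (λ x → f x + g x)
  Monic-+-lower {zero} (horner a h m e) (constant b g≡b) = horner (a + b) h m
    (λ x → trans (cong₂ _+_ (e x) (g≡b x)) (solve 4 (λ a b x u → (a :+ x :* u) :+ b := (a :+ b) :+ x :* u) refl a b x (h x)))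
  Monic-+-lower {suc n} (horner a h m e) (horner b g′ d e′) = horner (a + b) (λ x → h x + g′ x) (Monic-+-lower m d)
    (λ x → trans (cong₂ _+_ (e x) (e′ x))
      (solve 5 (λ a b x u v → (a :+ x :* u) :+ (b :+ x :* v) := (a :+ b) :+ x :* (u :+ v)) refl a b x (h x) (g′ x)))

  Monic-+ : ∀ {m n f g} → Monic n f → Degree≤ m g → m ℕ.< n → Monic n (λ x → f x + g x)
  Monic-+ {n = suc n} mf dg (s≤s m≤n) = Monic-+-lower mf (Degree≤-mono m≤n dg)

  Monic-power : ∀ n → Monic n (λ x → x ^ n)
  Monic-power zero = one (λ _ → refl)
  Monic-power (suc n) = horner 0# (λ x → x ^ n) (Monic-power n) (λ x → sym (+-identityˡ _))

  factor : ∀ {n f} → Monic (suc n) f → ∀ r → Σ (F → F) (λ g → Monic n g × (∀ x → f x + - f r ≡ (x + - r) * g x))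
  factor {zero} {f} (horner a g (one g≡1) e) r = (λ _ → 1#) , one (λ _ → refl) , λ x → begin
    f x + - f r                      ≡⟨ cong₂ (λ u v → u + - v) (e x) (e r) ⟩
    (a + x * g x) + - (a + r * g r)  ≡⟨ cong₂ (λ u v → (a + x * u) + - (a + r * v)) (g≡1 x) (g≡1 r) ⟩
    (a + x * 1#) + - (a + r * 1#)    ≡⟨ solve 4 (λ a x r o → (a :+ x :* o) :- (a :+ r :* o) := (x :- r) :* o) refl a x r 1# ⟩
    (x + - r) * 1#                   ∎
    where open ≡-Reasoning
  factor {suc n} {f} (horner a g mg e) r with factor mg r
  ... | g′ , mg′ , g-factored = (λ x → g x + r * g′ x) , Monic-+-lower mg (Degree≤-scale r (Monic⇒Degree≤ mg′)) , λ x → begin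
    f x + - f r
      ≡⟨ cong₂ (λ u v → u + - v) (e x) (e r) ⟩
    (a + x * g x) + - (a + r * g r)
      ≡⟨ solve 5 (λ a x r u v → (a :+ x :* u) :- (a :+ r :* v) := (x :- r) :* u :+ r :* (u :- v)) refl a x r (g x) (g r) ⟩
    (x + - r) * g x + r * (g x + - g r)
      ≡⟨ cong (λ w → (x + - r) * g x + r * w) (g-factored x) ⟩
    (x + - r) * g x + r * ((x + - r) * g′ x)
      ≡⟨ solve 4 (λ x r u v → (x :- r) :* u :+ r :* ((x :- r) :* v) := (x :- r) :* (u :+ r :* v)) refl x r (g x) (g′ x) ⟩
    (x + - r) * (g x + r * g′ x) ∎
    where open ≡-Reasoning

  root-bound : ∀ {n f} → Monic n f → (l : List F) → Unique l → (∀ {z} → z ∈ l → f z ≡ 0#) → length l ℕ.≤ n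
  root-bound m [] _ _ = z≤n
  root-bound (one f≡1) (r ∷ l) _ roots = ⊥-elim (1≢0 (trans (sym (f≡1 r)) (roots (here refl))))
  root-bound {suc n} {f} m (r ∷ l) (r∉l ∷ u) roots with factor m r
  ... | g , mg , f-factored = s≤s (root-bound mg l u g-roots)
    where
    r≢ : ∀ {x : F} {xs z} → All (x ≢_) xs → z ∈ xs → x ≢ z
    r≢ (x≢y ∷ _) (here refl) = x≢y
    r≢ (_ ∷ a) (there q) = r≢ a q
    -- the other roots of f are roots of g, since x - r ≠ 0 for them
    g-roots : ∀ {z} → z ∈ l → g z ≡ 0#
    g-roots {z} z∈l with no-zero-divisors {z + - r} {g z}
                     (trans (sym (f-factored z)) (trans (cong₂ (λ u v → u + - v) (roots (there z∈l)) (roots (here refl))) (-‿inverseʳ 0#)))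
    ... | inj₁ z-r≡0 = ⊥-elim (r≢ r∉l z∈l (sym (sub≡0⇒≡ z-r≡0)))
    ... | inj₂ gz≡0  = gz≡0

-- Every nonempty fibre
-- A⁻¹(y) is a translate of the kernel, so each value is taken exactly
-- |ker A| times, and |K| / |ker A| values are taken at all.
module AdditiveFibres (K : FiniteField) (A : FiniteField.F K → FiniteField.F K)
    (A-additive : ∀ x y → A (FiniteField._+_ K x y) ≡ FiniteField._+_ K (A x) (A y)) where
  open FiniteField K
  open FieldArithmetic K
  open FieldCounting K

  A-zero : A 0# ≡ 0#
  A-zero = +-cancelˡ-≡0 (trans (sym (A-additive 0# 0#)) (cong A (+-identityʳ 0#)))

  A-neg : ∀ x → A (- x) ≡ - A x
  A-neg x = begin
    A (- x)                  ≡⟨ solve 2 (λ u v → u := (u :+ v) :- v) refl (A (- x)) (A x) ⟩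
    (A (- x) + A x) + - A x  ≡⟨ cong (_+ - A x) (trans (sym (A-additive (- x) x)) (trans (cong A (-‿inverseˡ x)) A-zero)) ⟩
    0# + - A x               ≡⟨ +-identityˡ _ ⟩
    - A x                    ∎
    where open ≡-Reasoning

  kernelSize : ℕ
  kernelSize = count (λ x → A x ≟ 0#) elements

  kernelSize≥1 : 1 ℕ.≤ kernelSize
  kernelSize≥1 = count-≥1 (λ x → A x ≟ 0#) A-zero

  fibreSize : F → ℕ
  fibreSize y = occurrences A y

  valueCount : ℕ → ℕ
  valueCount j = count (λ y → fibreSize y ℕ.≟ j) elements

  -- Translation by a preimage x₀ of y maps the kernel onto the fibre of y.
  fibreSize-dichotomy : ∀ y → fibreSize y ≡ 0 ⊎ fibreSize y ≡ kernelSize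
  fibreSize-dichotomy y with fibreSize y ℕ.≟ 0
  ... | yes empty = inj₁ empty
  ... | no nonempty with count-witness (λ x → A x ≟ y) elements nonempty
  ...   | x₀ , Ax₀≡y = inj₂ (count-bijection (λ x → A x ≟ y) (λ x → A x ≟ 0#) (λ x → x + - x₀) (λ z → z + x₀)
            (λ x → solve 2 (λ x a → (x :- a) :+ a := x) refl x x₀)
            (λ z → solve 2 (λ z a → (z :+ a) :- a := z) refl z x₀)
            (λ x Ax≡y → trans (A-additive x (- x₀)) (trans (cong₂ _+_ Ax≡y (A-neg x₀))
                          (trans (cong (λ w → y + - w) Ax₀≡y) (-‿inverseʳ y))))
            (λ z Az≡0 → trans (A-additive z x₀) (trans (cong₂ _+_ Az≡0 Ax₀≡y) (+-identityˡ y))))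

  -- Summing the fibre sizes over all values counts K once.
  kernelSize*valueCount : kernelSize ℕ.* valueCount kernelSize ≡ size
  kernelSize*valueCount = trans (sym (sum-fibres elements)) (trans (fibre-sizes-sum A elements) length-elements)
    where
    sum-fibres : ∀ ys → sum (map fibreSize ys) ≡ kernelSize ℕ.* count (λ y → fibreSize y ℕ.≟ kernelSize) ys
    sum-fibres [] = sym (ℕP.*-zeroʳ kernelSize)
    sum-fibres (y ∷ ys) with fibreSize-dichotomy y
    ... | inj₁ empty = trans (cong₂ ℕ._+_ empty (sum-fibres ys))
        (cong (kernelSize ℕ.*_) (sym (count-reject (λ y → fibreSize y ℕ.≟ kernelSize)
          (λ full → ℕP.<⇒≢ kernelSize≥1 (trans (sym empty) full)))))
    ... | inj₂ full = trans (cong₂ ℕ._+_ full (sum-fibres ys))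
        (trans (sym (ℕP.*-suc kernelSize _)) (cong (kernelSize ℕ.*_) (sym (count-accept (λ y → fibreSize y ℕ.≟ kernelSize) full))))

  valueCount-0+kernelSize : valueCount 0 ℕ.+ valueCount kernelSize ≡ size
  valueCount-0+kernelSize = begin
    valueCount 0 ℕ.+ valueCount kernelSize
      ≡⟨ ℕP.+-comm (valueCount 0) _ ⟩
    valueCount kernelSize ℕ.+ valueCount 0
      ≡⟨ cong (valueCount kernelSize ℕ.+_) (count-cong (λ y → fibreSize y ℕ.≟ 0) (λ y → ¬? (fibreSize y ℕ.≟ kernelSize))
           (λ y empty full → ℕP.<⇒≢ kernelSize≥1 (trans (sym empty) full)) not-full⇒empty elements) ⟩
    valueCount kernelSize ℕ.+ count (λ y → ¬? (fibreSize y ℕ.≟ kernelSize)) elements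
      ≡⟨ count-complement (λ y → fibreSize y ℕ.≟ kernelSize) elements ⟩
    length elements
      ≡⟨ length-elements ⟩
    size ∎
    where
    open ≡-Reasoning
    not-full⇒empty : ∀ y → ¬ fibreSize y ≡ kernelSize → fibreSize y ≡ 0
    not-full⇒empty y ¬full with fibreSize-dichotomy y
    ... | inj₁ empty = empty
    ... | inj₂ full  = ⊥-elim (¬full full)

  valueCount-other : ∀ j → j ≢ 0 → j ≢ kernelSize → valueCount j ≡ 0
  valueCount-other j j≢0 j≢k = count-none (λ y → fibreSize y ℕ.≟ j) never elements
    where
    never : ∀ y → ¬ fibreSize y ≡ j
    never y fy≡j with fibreSize-dichotomy y
    ... | inj₁ empty = j≢0 (trans (sym fy≡j) empty)
    ... | inj₂ full  = j≢k (trans (sym fy≡j) full)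

  value-distribution : ∀ n → size ≡ kernelSize ℕ.* n →
                       (valueCount kernelSize ≡ n) × (valueCount 0 ≡ size ∸ n)
  value-distribution n size≡kn = full-count , empty-count
    where
    full-count : valueCount kernelSize ≡ n
    full-count = ℕP.*-cancelˡ-≡ _ _ kernelSize {{ℕ.>-nonZero kernelSize≥1}} (trans kernelSize*valueCount size≡kn)
    empty-count : valueCount 0 ≡ size ∸ n
    empty-count = trans (sym (ℕP.m+n∸n≡m (valueCount 0) (valueCount kernelSize)))
                        (cong₂ _∸_ valueCount-0+kernelSize full-count)

module FrobeniusPowers (K : FiniteField) {p s : ℕ} (p-prime : Prime p)
    (size≡p^s : FiniteField.size K ≡ p ℕ.^ s) where
  open FiniteField K
  open FieldArithmetic K
  open FermatAndCharacteristic K using (characteristic; fermat)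
  open FreshmansDream K using (freshmans-dream)
  open ≡-Reasoning

  -- K has characteristic p, because p^s · 1 = |K| · 1 = 0.
  ιp≡0 : ι p ≡ 0#
  ιp≡0 = ^≡0⇒≡0 s (trans (sym (ι-^ p s)) (trans (cong ι (sym size≡p^s)) characteristic))

  Fr : ℕ → F → F
  Fr n x = x ^ (p ℕ.^ n)

  Fr-zero : ∀ x → Fr 0 x ≡ x
  Fr-zero x = *-identityʳ x

  Fr-∘ : ∀ m n x → Fr (m ℕ.+ n) x ≡ Fr n (Fr m x)
  Fr-∘ m n x = trans (cong (x ^_) (ℕP.^-distribˡ-+-* p m n)) (^-* x (p ℕ.^ m) (p ℕ.^ n))

  Fr-additive : ∀ n x y → Fr n (x + y) ≡ Fr n x + Fr n y
  Fr-additive zero x y = trans (Fr-zero (x + y)) (sym (cong₂ _+_ (Fr-zero x) (Fr-zero y)))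
  Fr-additive (suc n) x y = begin
    Fr (suc n) (x + y)           ≡⟨ Fr-suc (x + y) ⟩
    Fr n ((x + y) ^ p)           ≡⟨ cong (Fr n) (freshmans-dream p-prime ιp≡0 x y) ⟩
    Fr n (x ^ p + y ^ p)         ≡⟨ Fr-additive n (x ^ p) (y ^ p) ⟩
    Fr n (x ^ p) + Fr n (y ^ p)  ≡⟨ sym (cong₂ _+_ (Fr-suc x) (Fr-suc y)) ⟩
    Fr (suc n) x + Fr (suc n) y  ∎
    where
    Fr-suc : ∀ z → Fr (suc n) z ≡ Fr n (z ^ p)
    Fr-suc z = trans (Fr-∘ 1 n z) (cong (λ e → Fr n (z ^ e)) (ℕP.*-identityʳ p))

  Fr-multiplicative : ∀ n x y → Fr n (x * y) ≡ Fr n x * Fr n y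
  Fr-multiplicative n x y = *-^ x y (p ℕ.^ n)

  Fr-s : ∀ x → Fr s x ≡ x
  Fr-s x = subst (λ e → x ^ e ≡ x) size≡p^s (fermat x)

  Fr-iterate : ∀ t n x → Fr t x ≡ x → Fr (t ℕ.* n) x ≡ x
  Fr-iterate t zero x _ = trans (cong (λ e → Fr e x) (ℕP.*-zeroʳ t)) (Fr-zero x)
  Fr-iterate t (suc n) x fixed = begin
    Fr (t ℕ.* suc n) x       ≡⟨ cong (λ e → Fr e x) (ℕP.*-suc t n) ⟩
    Fr (t ℕ.+ t ℕ.* n) x     ≡⟨ Fr-∘ t (t ℕ.* n) x ⟩
    Fr (t ℕ.* n) (Fr t x)    ≡⟨ cong (Fr (t ℕ.* n)) fixed ⟩
    Fr (t ℕ.* n) x           ≡⟨ Fr-iterate t n x fixed ⟩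
    x                        ∎

-- At most p^h: they are roots of  x^(p^h) - x.  At least p^h: the additive map
-- Φ x = x^(p^h) - x  takes its values among the roots of the trace polynomial
-- y + y^(p^h) + ⋯ + y^(p^(h(m-1)))  (m = s/h), of degree p^(h(m-1)); since every
-- value of Φ is taken |ker Φ| times,  p^(hm) ≤ |ker Φ| · p^(h(m-1)).
module FrobeniusFixedPoints (K : FiniteField) {p s : ℕ} (p-prime : Prime p)
    (size≡p^s : FiniteField.size K ≡ p ℕ.^ s) (0<s : 0 ℕ.< s) (h : ℕ) (h∣s : h ℕ∣.∣ s) where
  open FiniteField K
  open FieldArithmetic K
  open FieldCounting K
  open PolynomialFunctions K
  open FrobeniusPowers K {s = s} p-prime size≡p^s

  D : ℕ
  D = p ℕ.^ h

  s≡h*quotient : s ≡ h ℕ.* ℕ∣.quotient h∣s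
  s≡h*quotient = trans (ℕ∣._∣_.equality h∣s) (ℕP.*-comm (ℕ∣.quotient h∣s) h)

  size≡D^ : ∀ {n} → s ≡ h ℕ.* n → size ≡ D ℕ.^ n
  size≡D^ {n} s≡h*n = trans size≡p^s (trans (cong (p ℕ.^_) s≡h*n) (sym (ℕP.^-*-assoc p h n)))

  1<D : 1 ℕ.< D
  1<D = ℕP.^-monoʳ-< p (ℕ.nonTrivial⇒n>1 p {{prime⇒nonTrivial p-prime}}) (ℕP.n≢0⇒n>0 h≢0)
    where
    h≢0 : h ≢ 0
    h≢0 refl = ℕP.<⇒≢ 0<s (sym (ℕ∣.0∣⇒≡0 h∣s))

  instance
    D≢0 : ℕ.NonZero D
    D≢0 = ℕ.>-nonZero (ℕP.<-trans (s≤s z≤n) 1<D)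

  fixedCount : ℕ
  fixedCount = count (λ z → Fr h z ≟ z) elements

  -- x^D - x is monic of degree D, and every fixed point is a root.
  fixedCount≤D : fixedCount ℕ.≤ D
  fixedCount≤D = root-bound x^D-x (filter (λ z → Fr h z ≟ z) elements)
                   (Unique.filter⁺ (λ z → Fr h z ≟ z) elements-unique)
                   (λ z∈ → ≡⇒sub≡0 (proj₂ (∈-filter⁻ (λ z → Fr h z ≟ z) {xs = elements} z∈)))
    where
    x^D-x : Monic D (λ x → x ^ D + - x)
    x^D-x = Monic-+ (Monic-power D)
      (horner 0# (λ _ → - 1#) (constant (- 1#) (λ _ → refl))
        (λ x → sym (trans (+-identityˡ _) (trans (sym (-‿distribʳ-* x 1#)) (cong -_ (*-identityʳ x))))))
      1<D

  Φ : F → F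
  Φ x = Fr h x + - x

  Φ-additive : ∀ x y → Φ (x + y) ≡ Φ x + Φ y
  Φ-additive x y = trans (cong (_+ - (x + y)) (Fr-additive h x y))
    (solve 4 (λ a b x y → (a :+ b) :- (x :+ y) := (a :- x) :+ (b :- y)) refl (Fr h x) (Fr h y) x y)

  module ΦFibres = AdditiveFibres K Φ Φ-additive
  open ΦFibres using (kernelSize; fibreSize; valueCount; kernelSize≥1; kernelSize*valueCount)

  fixedCount≡kernelSize : fixedCount ≡ kernelSize
  fixedCount≡kernelSize = count-cong (λ z → Fr h z ≟ z) (λ x → Φ x ≟ 0#)
    (λ _ → ≡⇒sub≡0) (λ _ → sub≡0⇒≡) elements

  trace : ℕ → F → F
  trace zero y = 0#
  trace (suc j) y = Fr (h ℕ.* j) y + trace j y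

  -- The trace of Φ x telescopes.
  trace-Φ : ∀ j x → trace j (Φ x) ≡ Fr (h ℕ.* j) x + - x
  trace-Φ zero x = sym (trans (cong (λ e → Fr e x + - x) (ℕP.*-zeroʳ h))
                              (trans (cong (_+ - x) (Fr-zero x)) (-‿inverseʳ x)))
  trace-Φ (suc j) x = begin
    Fr (h ℕ.* j) (Fr h x + - x) + trace j (Φ x)
      ≡⟨ cong₂ _+_ (trans (Fr-additive (h ℕ.* j) (Fr h x) (- x)) (cong (Fr (h ℕ.* j) (Fr h x) +_) (Fr-neg (h ℕ.* j) x)))
                   (trace-Φ j x) ⟩
    (Fr (h ℕ.* j) (Fr h x) + - Fr (h ℕ.* j) x) + (Fr (h ℕ.* j) x + - x)
      ≡⟨ solve 3 (λ a b x → (a :- b) :+ (b :- x) := a :- x) refl _ _ x ⟩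
    Fr (h ℕ.* j) (Fr h x) + - x
      ≡⟨ cong (_+ - x) (sym (trans (cong (λ e → Fr e x) (ℕP.*-suc h j)) (Fr-∘ h (h ℕ.* j) x))) ⟩
    Fr (h ℕ.* suc j) x + - x ∎
    where
    open ≡-Reasoning
    Fr-neg : ∀ n x → Fr n (- x) ≡ - Fr n x
    Fr-neg n = AdditiveFibres.A-neg K (Fr n) (Fr-additive n)

  -- trace (j + 1) is monic of degree D^j: its top term is y^(D^j).
  trace-monic : ∀ j → Monic (D ℕ.^ j) (trace (suc j))
  trace-monic j = Monic-cong (Monic-+ (Monic-power (D ℕ.^ j)) (lower j) (lower<D^j j))
                    (λ y → cong (_+ trace j y) (cong (y ^_) (sym (ℕP.^-*-assoc p h j))))
    where
    lowerDegree : ℕ → ℕ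
    lowerDegree zero = 0
    lowerDegree (suc j) = D ℕ.^ j
    lower : ∀ j → Degree≤ (lowerDegree j) (trace j)
    lower zero = constant 0# (λ _ → refl)
    lower (suc j) = Monic⇒Degree≤ (trace-monic j)
    lower<D^j : ∀ j → lowerDegree j ℕ.< D ℕ.^ j
    lower<D^j zero = s≤s z≤n
    lower<D^j (suc j) = subst (ℕ._< D ℕ.^ suc j) (ℕP.*-identityˡ (D ℕ.^ j))
                          (ℕP.*-monoˡ-< (D ℕ.^ j) {{ℕP.m^n≢0 D j {{D≢0}}}} 1<D)

  kernel-large : ∀ m′ → s ≡ h ℕ.* suc m′ → D ℕ.≤ kernelSize
  kernel-large m′ s≡h*[1+m′] = ℕP.*-cancelʳ-≤ D kernelSize (D ℕ.^ m′) {{ℕP.m^n≢0 D m′ {{D≢0}}}} (begin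
    D ℕ.* D ℕ.^ m′              ≡⟨ sym (size≡D^ s≡h*[1+m′]) ⟩
    size                          ≡⟨ sym kernelSize*valueCount ⟩
    kernelSize ℕ.* valueCount kernelSize  ≤⟨ ℕP.*-monoʳ-≤ kernelSize value-bound ⟩
    kernelSize ℕ.* D ℕ.^ m′      ∎)
    where
    open ℕP.≤-Reasoning
    values = filter (λ y → fibreSize y ℕ.≟ kernelSize) elements
    -- every value of Φ is a root of trace (m′ + 1), because Fr s = id
    trace-Φ-vanishes : ∀ x → trace (suc m′) (Φ x) ≡ 0#
    trace-Φ-vanishes x = trans (trace-Φ (suc m′) x)
      (trans (cong (λ e → Fr e x + - x) (sym s≡h*[1+m′])) (trans (cong (_+ - x) (Fr-s x)) (-‿inverseʳ x)))
    values-are-roots : ∀ {y} → y ∈ values → trace (suc m′) y ≡ 0#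
    values-are-roots {y} y∈ = root (count-witness (λ x → Φ x ≟ y) elements fibre≢0)
      where
      fibre≢0 : fibreSize y ≢ 0
      fibre≢0 empty = ℕP.<⇒≢ kernelSize≥1 (trans (sym empty) (proj₂ (∈-filter⁻ (λ y → fibreSize y ℕ.≟ kernelSize) {xs = elements} y∈)))
      root : Σ F (λ x → Φ x ≡ y) → trace (suc m′) y ≡ 0#
      root (x , Φx≡y) = subst (λ z → trace (suc m′) z ≡ 0#) Φx≡y (trace-Φ-vanishes x)
    value-bound : valueCount kernelSize ℕ.≤ D ℕ.^ m′
    value-bound = root-bound (trace-monic m′) values
                    (Unique.filter⁺ (λ y → fibreSize y ℕ.≟ kernelSize) elements-unique) values-are-roots

  fixedCount≡D : fixedCount ≡ D
  fixedCount≡D = ℕP.≤-antisym fixedCount≤D (subst (D ℕ.≤_) (sym fixedCount≡kernelSize) D≤kernelSize)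
    where
    D≤kernelSize : D ℕ.≤ kernelSize
    D≤kernelSize with ℕ∣.quotient h∣s | s≡h*quotient
    ... | zero   | s≡0       = ⊥-elim (ℕP.<⇒≢ 0<s (sym (trans s≡0 (ℕP.*-zeroʳ h))))
    ... | suc m′ | s≡h*[1+m′] = kernel-large m′ s≡h*[1+m′]

module TwistedFrobenius (K : FiniteField) {p s i : ℕ} (p-prime : Prime p)
    (size≡p^s : FiniteField.size K ≡ p ℕ.^ s) (i<s : i < s) (c : FiniteField.F K) where
  open FiniteField K
  open FieldArithmetic K
  open FieldCounting K
  open FrobeniusPowers K {s = s} p-prime size≡p^s
  open ≡-Reasoning

  h : ℕ
  h = gcd i s

  0<s : 0 < s
  0<s = ℕP.<-≤-trans (ℕ.s≤s ℕ.z≤n) i<s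

  open FrobeniusFixedPoints K p-prime size≡p^s 0<s h (gcd[m,n]∣n i s)
    using (D; 1<D; fixedCount; fixedCount≡D)

  d : ℕ
  d = D ∸ 1

  D≡1+d : D ≡ suc d
  D≡1+d = sym (trans (ℕP.+-comm 1 d) (ℕP.m∸n+n≡m (ℕP.<⇒≤ 1<D)))

  L : F → F
  L x = x ^ (p ℕ.^ i) + - (c * x)

  L-additive : ∀ x y → L (x + y) ≡ L x + L y
  L-additive x y = trans (cong (_+ - (c * (x + y))) (Fr-additive i x y))
    (solve 5 (λ a b c x y → (a :+ b) :- (c :* (x :+ y)) := (a :- c :* x) :+ (b :- c :* y)) refl (Fr i x) (Fr i y) c x y)

  open AdditiveFibres K L L-additive

  -- p^i = 1 + d G  for some G, because h ∣ i and  p^(h a) - 1 = (1 + d)^a - 1.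
  G : ℕ
  G = proj₁ (geometric-quotient d (ℕ∣.quotient (gcd[m,n]∣m i s)))

  p^i≡1+d*G : p ℕ.^ i ≡ suc (d ℕ.* G)
  p^i≡1+d*G = begin
    p ℕ.^ i          ≡⟨ cong (p ℕ.^_) (trans (ℕ∣._∣_.equality (gcd[m,n]∣m i s)) (ℕP.*-comm a h)) ⟩
    p ℕ.^ (h ℕ.* a)  ≡⟨ sym (ℕP.^-*-assoc p h a) ⟩
    D ℕ.^ a          ≡⟨ cong (ℕ._^ a) D≡1+d ⟩
    suc d ℕ.^ a      ≡⟨ Data.Product.proj₂ (geometric-quotient d a) ⟩
    suc (d ℕ.* G)  ∎
    where a = ℕ∣.quotient (gcd[m,n]∣m i s)

  pow-1+e*g : ∀ x e g → x ^ suc (e ℕ.* g) ≡ x * (x ^ g) ^ e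
  pow-1+e*g x e g = cong (x *_) (trans (cong (x ^_) (ℕP.*-comm e g)) (^-* x g e))

  -- Some iterate of Fr i equals Fr h: from Bézout  a i = h + b s, as Fr s = id.
  iterate-reaches-h : ∀ a b → a ℕ.* i ≡ h ℕ.+ b ℕ.* s → ∀ z → Fr (i ℕ.* a) z ≡ Fr h z
  iterate-reaches-h a b a*i≡h+b*s z = begin
    Fr (i ℕ.* a) z          ≡⟨ cong (λ e → Fr e z) (trans (ℕP.*-comm i a) a*i≡h+b*s) ⟩
    Fr (h ℕ.+ b ℕ.* s) z    ≡⟨ Fr-∘ h (b ℕ.* s) z ⟩
    Fr (b ℕ.* s) (Fr h z)   ≡⟨ cong (λ e → Fr e (Fr h z)) (ℕP.*-comm b s) ⟩
    Fr (s ℕ.* b) (Fr h z)   ≡⟨ Fr-iterate s b (Fr h z) (Fr-s (Fr h z)) ⟩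
    Fr h z                  ∎

  -- For i = 0 we have h = s and Fr 0 = Fr s = id.
  frobenius-bezout : Σ ℕ (λ a → ∀ z → Fr (i ℕ.* a) z ≡ Fr h z)
  frobenius-bezout = by-cases (i ℕ.≟ 0)
    where
    by-cases : Dec (i ≡ 0) → Σ ℕ (λ a → ∀ z → Fr (i ℕ.* a) z ≡ Fr h z)
    by-cases (yes i≡0) = 0 , λ z → begin
      Fr (i ℕ.* 0) z  ≡⟨ cong (λ e → Fr e z) (ℕP.*-zeroʳ i) ⟩
      Fr 0 z          ≡⟨ Fr-zero z ⟩
      z               ≡⟨ sym (Fr-s z) ⟩
      Fr s z          ≡⟨ cong (λ e → Fr e z) (sym (trans (cong (λ t → gcd t s) i≡0) (gcd-identityˡ s))) ⟩
      Fr h z          ∎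
    by-cases (no i≢0) with bezout (gcd-GCD i s) (ℕP.n≢0⇒n>0 i≢0) 0<s
    ... | a , b , a*i≡h+b*s = a , iterate-reaches-h a b a*i≡h+b*s

  -- Hence Fr i and Fr h have the same fixed points (h ∣ i gives the converse).
  fixed-h⇒fixed-i : ∀ z → Fr h z ≡ z → Fr i z ≡ z
  fixed-h⇒fixed-i z fixed = trans (cong (λ e → Fr e z) i≡h*a) (Fr-iterate h a z fixed)
    where
    a = ℕ∣.quotient (gcd[m,n]∣m i s)
    i≡h*a = trans (ℕ∣._∣_.equality (gcd[m,n]∣m i s)) (ℕP.*-comm a h)

  fixed-i⇒fixed-h : ∀ z → Fr i z ≡ z → Fr h z ≡ z
  fixed-i⇒fixed-h z fixed = trans (sym (proj₂ frobenius-bezout z)) (Fr-iterate i (proj₁ frobenius-bezout) z fixed)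

  -- If L_c has a nonzero root x, then c = (x^G)^d is a nonzero d-th power.
  kernel-trivial : ¬ C₀ d c → kernelSize ≡ 1
  kernel-trivial not-power = count-unique (λ x → L x ≟ 0#) 0# A-zero only-zero
    where
    nonzero-root⇒power : ∀ x → x ≢ 0# → L x ≡ 0# → C₀ d c
    nonzero-root⇒power x x≢0 Lx≡0 = c≢0 , x ^ G , *-cancelˡ x≢0 (begin
      x * (x ^ G) ^ d      ≡⟨ sym (pow-1+e*g x d G) ⟩
      x ^ suc (d ℕ.* G)    ≡⟨ cong (x ^_) (sym p^i≡1+d*G) ⟩
      Fr i x               ≡⟨ Frx≡cx ⟩
      c * x                ≡⟨ *-comm c x ⟩
      x * c                ∎)
      where
      Frx≡cx : Fr i x ≡ c * x
      Frx≡cx = sub≡0⇒≡ Lx≡0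
      c≢0 : c ≢ 0#
      c≢0 c≡0 = x≢0 (^≡0⇒≡0 (p ℕ.^ i) (trans Frx≡cx (trans (cong (_* x) c≡0) (zeroˡ x))))
    only-zero : ∀ x → L x ≡ 0# → x ≡ 0#
    only-zero x Lx≡0 = decidable-stable (x ≟ 0#) (λ x≢0 → not-power (nonzero-root⇒power x x≢0 Lx≡0))

  -- If c = y^d with c ≠ 0, then x₀ = y^G′ is a nonzero root of L_c, where
  -- (1 + d G)^a = 1 + d G G′ for the exponent a of frobenius-bezout.
  twisted-root : C₀ d c → Σ F (λ x₀ → (x₀ ≢ 0#) × (Fr i x₀ ≡ c * x₀))
  twisted-root (c≢0 , y , y^d≡c) = x₀ , ^≢0 G′ y≢0 , (begin
    Fr i x₀                  ≡⟨ cong (x₀ ^_) p^i≡1+d*G ⟩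
    x₀ * x₀ ^ (d ℕ.* G)      ≡⟨ cong (x₀ *_) x₀^dG≡c ⟩
    x₀ * c                   ≡⟨ *-comm x₀ c ⟩
    c * x₀                   ∎)
    where
    a : ℕ
    a = proj₁ frobenius-bezout
    G′ : ℕ
    G′ = proj₁ (geometric-quotient (d ℕ.* G) a)
    x₀ : F
    x₀ = y ^ G′
    y≢0 : y ≢ 0#
    y≢0 y≡0 = c≢0 (trans (sym y^d≡c) (trans (cong (_^ d) y≡0) (0^n≡0 (ℕP.m<n⇒0<n∸m 1<D))))
    x₀^dG≡c : x₀ ^ (d ℕ.* G) ≡ c
    x₀^dG≡c = *-cancelˡ y≢0 (begin
      y * x₀ ^ (d ℕ.* G)             ≡⟨ sym (pow-1+e*g y (d ℕ.* G) G′) ⟩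
      y ^ suc (d ℕ.* G ℕ.* G′)       ≡⟨ cong (y ^_) (sym (proj₂ (geometric-quotient (d ℕ.* G) a))) ⟩
      y ^ (suc (d ℕ.* G) ℕ.^ a)      ≡⟨ cong (λ e → y ^ (e ℕ.^ a)) (sym p^i≡1+d*G) ⟩
      y ^ ((p ℕ.^ i) ℕ.^ a)          ≡⟨ cong (y ^_) (ℕP.^-*-assoc p i a) ⟩
      Fr (i ℕ.* a) y                 ≡⟨ proj₂ frobenius-bezout y ⟩
      y ^ D                          ≡⟨ cong (y ^_) D≡1+d ⟩
      y * y ^ d                      ≡⟨ cong (y *_) y^d≡c ⟩
      y * c                          ∎)

  -- Dividing by x₀ maps the kernel of L_c onto the fixed points of Fr i,
  -- which are those of Fr h.
  kernel-full : C₀ d c → kernelSize ≡ D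
  kernel-full is-power = begin
    kernelSize                           ≡⟨ count-bijection (λ x → L x ≟ 0#) (λ z → Fr i z ≟ z) (u *_) (x₀ *_)
                                              x₀[ux]≡x u[x₀z]≡z kernel⇒fixed fixed⇒kernel ⟩
    count (λ z → Fr i z ≟ z) elements    ≡⟨ count-cong (λ z → Fr i z ≟ z) (λ z → Fr h z ≟ z)
                                              fixed-i⇒fixed-h fixed-h⇒fixed-i elements ⟩
    fixedCount                           ≡⟨ fixedCount≡D ⟩
    D                                    ∎
    where
    x₀ : F
    x₀ = proj₁ (twisted-root is-power)
    x₀≢0 : x₀ ≢ 0#
    x₀≢0 = proj₁ (proj₂ (twisted-root is-power))
    Frx₀≡cx₀ : Fr i x₀ ≡ c * x₀
    Frx₀≡cx₀ = proj₂ (proj₂ (twisted-root is-power))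
    u : F
    u = proj₁ (inverse x₀ x₀≢0)
    x₀u≡1 : x₀ * u ≡ 1#
    x₀u≡1 = proj₂ (inverse x₀ x₀≢0)
    x₀[ux]≡x : ∀ x → x₀ * (u * x) ≡ x
    x₀[ux]≡x x = trans (sym (*-assoc x₀ u x)) (trans (cong (_* x) x₀u≡1) (*-identityˡ x))
    u[x₀z]≡z : ∀ z → u * (x₀ * z) ≡ z
    u[x₀z]≡z z = trans (sym (*-assoc u x₀ z)) (trans (cong (_* z) (trans (*-comm u x₀) x₀u≡1)) (*-identityˡ z))
    kernel⇒fixed : ∀ x → L x ≡ 0# → Fr i (u * x) ≡ u * x
    kernel⇒fixed x Lx≡0 = *-cancelˡ (*-≢0 c≢0 x₀≢0) (begin
      (c * x₀) * Fr i (u * x)   ≡⟨ cong (_* Fr i (u * x)) (sym Frx₀≡cx₀) ⟩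
      Fr i x₀ * Fr i (u * x)    ≡⟨ sym (Fr-multiplicative i x₀ (u * x)) ⟩
      Fr i (x₀ * (u * x))       ≡⟨ cong (Fr i) (x₀[ux]≡x x) ⟩
      Fr i x                    ≡⟨ sub≡0⇒≡ Lx≡0 ⟩
      c * x                     ≡⟨ cong (c *_) (sym (x₀[ux]≡x x)) ⟩
      c * (x₀ * (u * x))        ≡⟨ sym (*-assoc c x₀ _) ⟩
      (c * x₀) * (u * x)        ∎)
      where c≢0 = proj₁ is-power
    fixed⇒kernel : ∀ z → Fr i z ≡ z → L (x₀ * z) ≡ 0#
    fixed⇒kernel z fixed = ≡⇒sub≡0 (trans (Fr-multiplicative i x₀ z)
                             (trans (cong₂ _*_ Frx₀≡cx₀ fixed) (*-assoc c x₀ z)))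

  p^s≡D*p^[s-h] : p ℕ.^ s ≡ D ℕ.* p ℕ.^ (s ∸ h)
  p^s≡D*p^[s-h] = trans (cong (p ℕ.^_) (sym (ℕP.m+[n∸m]≡n h≤s))) (ℕP.^-distribˡ-+-* p h (s ∸ h))
    where
    h≤s : h ℕ.≤ s
    h≤s = ℕ∣.∣⇒≤ {{ℕ.>-nonZero 0<s}} (gcd[m,n]∣n i s)

  distribution-power : C₀ d c → (valueCount 0 ≡ p ℕ.^ s ∸ p ℕ.^ (s ∸ h)) × (valueCount D ≡ p ℕ.^ (s ∸ h))
                                × ((j : ℕ) → j ≢ 0 → j ≢ D → valueCount j ≡ 0)
  distribution-power is-power =
    trans (proj₂ distribution) (cong (_∸ p ℕ.^ (s ∸ h)) size≡p^s) ,
    trans (cong valueCount (sym k≡D)) (proj₁ distribution) ,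
    λ j j≢0 j≢D → valueCount-other j j≢0 (λ j≡k → j≢D (trans j≡k k≡D))
    where
    k≡D : kernelSize ≡ D
    k≡D = kernel-full is-power
    distribution : (valueCount kernelSize ≡ p ℕ.^ (s ∸ h)) × (valueCount 0 ≡ size ∸ p ℕ.^ (s ∸ h))
    distribution = value-distribution (p ℕ.^ (s ∸ h))
      (trans size≡p^s (trans p^s≡D*p^[s-h] (cong (ℕ._* p ℕ.^ (s ∸ h)) (sym k≡D))))

  distribution-non-power : ¬ C₀ d c → (valueCount 1 ≡ p ℕ.^ s) × ((j : ℕ) → j ≢ 1 → valueCount j ≡ 0)
  distribution-non-power not-power = trans (cong valueCount (sym k≡1)) (proj₁ distribution) , others
    where
    k≡1 : kernelSize ≡ 1
    k≡1 = kernel-trivial not-power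
    distribution : (valueCount kernelSize ≡ p ℕ.^ s) × (valueCount 0 ≡ size ∸ p ℕ.^ s)
    distribution = value-distribution (p ℕ.^ s)
      (trans size≡p^s (sym (trans (cong (ℕ._* p ℕ.^ s) k≡1) (ℕP.*-identityˡ (p ℕ.^ s)))))
    others : (j : ℕ) → j ≢ 1 → valueCount j ≡ 0
    others zero _ = trans (proj₂ distribution) (trans (cong (_∸ p ℕ.^ s) size≡p^s) (ℕP.n∸n≡0 (p ℕ.^ s)))
    others (suc j) j≢1 = valueCount-other (suc j) (λ ()) (λ j≡k → j≢1 (trans j≡k k≡1))

open import Data.Nat using (_^_)
open FiniteField using (F; M; C₀) renaming (_^_ to pow)

-- Proposition B.1: M_j(x^(p^i), c) counts the values of L_c taken exactly j
-- times, i.e. it is  valueCount j  for the additive map L_c.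
propositionB1 : (K : FiniteField) → (p s i : ℕ) → Prime p
    → FiniteField.size K ≡ p ^ s → i < s → (c : F K)
    → (C₀ K (p ^ gcd i s ∸ 1) c
        → (M K 0 (λ x → pow K x (p ^ i)) c ≡ p ^ s ∸ p ^ (s ∸ gcd i s))
          × (M K (p ^ gcd i s) (λ x → pow K x (p ^ i)) c ≡ p ^ (s ∸ gcd i s))
          × ((j : ℕ) → j ≢ 0 → j ≢ p ^ gcd i s → M K j (λ x → pow K x (p ^ i)) c ≡ 0))
      × (¬ C₀ K (p ^ gcd i s ∸ 1) c
        → (M K 1 (λ x → pow K x (p ^ i)) c ≡ p ^ s)
          × ((j : ℕ) → j ≢ 1 → M K j (λ x → pow K x (p ^ i)) c ≡ 0))
propositionB1 K p s i p-prime size≡p^s i<s c = distribution-power , distribution-non-power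
  where open TwistedFrobenius K p-prime size≡p^s i<s c
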